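{- For every graph $G$, every integer $r\geq 0$, every integer $\ell\geq 1$, every $r$-shallow minor $H$ of $G\boxtimes K_\ell$, and every integer $s\geq 1$, $$\mathrm{scol}_s(H)\leq \ell\,\mathrm{scol}_{2rs+2r+s}(G)\quad\text{and}\quad \mathrm{wcol}_s(H)\leq \ell\,\mathrm{wcol}_{2rs+2r+s}(G).$$
   Context: All graphs are finite and simple. The strong product $A\boxtimes B$ has vertex set $V(A)\times V(B)$, with distinct $(a,v),(b,u)$ adjacent iff ($a=b$ or $ab\in E(A)$) and ($u=v$ or $uv\in E(B)$). $H$ is an $r$-shallow minor of $X$ if there is a map $\mu$ assigning to each $v\in V(H)$ a connected subgraph $\mu(v)$ of $X$ of radius at most $r$, the $\mu(v)$ pairwise vertex-disjoint, such that for every edge $vw\in E(H)$ some edge of $X$ joins $\mu(v)$ and $\mu(w)$. For a graph $G$, a total order $\preceq$ on $V(G)$, $v\in V(G)$ and integer $s\geq1$: $R(G,\preceq,v,s)$ is the set of $w\in V(G)$ with $w\preceq v$ for which there is a path $v=w_0,w_1,\dots,w_{s'}=w$ with $s'\in[0,s]$ and $v\prec w_i$ for all internal vertices $w_i$ ($1\le i\le s'-1$); $Q(G,\preceq,v,s)$ is the set of $w\in V(G)$ with $w\preceq v$ for which there is such a path with $w\prec w_i$ for all internal vertices $w_i$. The $s$-strong colouring number $\mathrm{scol}_s(G)$ (resp. $s$-weak colouring number $\mathrm{wcol}_s(G)$) is the minimum over total orders $\preceq$ of $\max_v |R(G,\preceq,v,s)|$ (resp. $\max_v|Q(G,\preceq,v,s)|$).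 -}

module Defs where

open import Level using (0ℓ)
open import Data.Nat using (ℕ; zero; suc; _≤_; _<_)
open import Data.Fin using (Fin; toℕ; fromℕ; inject₁) renaming (zero to fzero; suc to fsuc)
import Data.Fin as Fin
open import Data.Product using (Σ; Σ-syntax; ∃; _×_; _,_; proj₁; proj₂)
open import Data.Product.Properties using (≡-dec)
open import Data.Product.Function.NonDependent.Propositional using (_×-↔_)
open import Data.Sum using (_⊎_; inj₁; inj₂)
open import Data.Empty using (⊥)
open import Data.List using (List; length)
open import Data.List.Membership.Propositional using (_∈_)
open import Relation.Nullary using (¬_; Dec; yes; no)
open import Relation.Nullary.Decidable using (_×-dec_; _⊎-dec_; ¬?)
open import Relation.Binary.Definitions using (DecidableEquality)
open import Relation.Binary.Structures using (IsTotalOrder)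
open import Relation.Binary.PropositionalEquality using (_≡_; _≢_; refl; sym)
open import Function.Bundles using (_↔_)
open import Function.Definitions using (Injective)
open import Function.Properties.Inverse using (↔-trans)
open import Data.Fin.Properties using (*↔×)
open import Data.Fin.Properties using () renaming (_≟_ to _≟F_)

record Graph : Set₁ where
  field
    V       : Set
    size    : ℕ
    enum    : V ↔ Fin size
    _≟V_    : DecidableEquality V
    E       : V → V → Set
    E?      : ∀ x y → Dec (E x y)
    E-sym   : ∀ {x y} → E x y → E y x
    E-irr   : ∀ {x} → ¬ E x x

open Graph public

K : ℕ → Graph
K ℓ = record
  { V = Fin ℓ ; size = ℓ ; enum = *↔×-refl
  ; _≟V_ = _≟F_
  ; E = λ i j → i ≢ j
  ; E? = λ i j → ¬? (i ≟F j)
  ; E-sym = λ ne eq → ne (sym eq)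
  ; E-irr = λ ne → ne refl }
  where
    open import Function.Properties.Inverse using () renaming (↔-refl to *↔×-refl)

_⊠_ : Graph → Graph → Graph
A ⊠ B = record
  { V = V A × V B
  ; size = size A Data.Nat.* size B
  ; enum = ↔-trans (enum A ×-↔ enum B) (↔-sym′ *↔×)
  ; _≟V_ = ≡-dec (_≟V_ A) (_≟V_ B)
  ; E = SE
  ; E? = λ { (a , u) (b , v) →
        ¬? (≡-dec (_≟V_ A) (_≟V_ B) (a , u) (b , v))
        ×-dec ((_≟V_ A a b ⊎-dec E? A a b) ×-dec (_≟V_ B u v ⊎-dec E? B u v)) }
  ; E-sym = λ { (ne , ea , eb) → (λ eq → ne (sym eq)) , flipA ea , flipB eb }
  ; E-irr = λ { (ne , _) → ne refl } }
  where
    open import Function.Properties.Inverse using () renaming (↔-sym to ↔-sym′)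
    SE : V A × V B → V A × V B → Set
    SE (a , u) (b , v) = ((a , u) ≢ (b , v)) × ((a ≡ b ⊎ E A a b) × (u ≡ v ⊎ E B u v))
    flipA : ∀ {a b} → a ≡ b ⊎ E A a b → b ≡ a ⊎ E A b a
    flipA (inj₁ eq) = inj₁ (sym eq)
    flipA (inj₂ e)  = inj₂ (E-sym A e)
    flipB : ∀ {a b} → a ≡ b ⊎ E B a b → b ≡ a ⊎ E B b a
    flipB (inj₁ eq) = inj₁ (sym eq)
    flipB (inj₂ e)  = inj₂ (E-sym B e)

data Walk {X : Set} (R : X → X → Set) : X → X → ℕ → Set where
  nil  : ∀ {x} → Walk R x x 0
  cons : ∀ {x y z k} → R x y → Walk R y z k → Walk R x z (suc k)

record Subgraph (X : Graph) : Set₁ where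
  field
    Vs : V X → Set
    Es : V X → V X → Set
    Es⊆E  : ∀ {x y} → Es x y → E X x y
    Es-Vs : ∀ {x y} → Es x y → Vs x × Vs y
    Es-sym : ∀ {x y} → Es x y → Es y x

open Subgraph public

-- connected with radius ≤ r: some centre c in the subgraph such that every
-- vertex of the subgraph is at distance ≤ r from c within the subgraph
-- (this implies connectivity and non-emptiness).
RadiusAtMost : {X : Graph} → ℕ → Subgraph X → Set
RadiusAtMost {X} r S =
  Σ[ c ∈ V X ] (Vs S c × (∀ x → Vs S x → Σ[ k ∈ ℕ ] (k ≤ r × Walk (Es S) c x k)))

record ShallowMinor (r : ℕ) (H X : Graph) : Set₁ where
  field
    μ        : V H → Subgraph X
    radius   : ∀ v → RadiusAtMost r (μ v)
    disjoint : ∀ {v w} → v ≢ w → ∀ x → Vs (μ v) x → Vs (μ w) x → ⊥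
    edges    : ∀ {v w} → E H v w →
               Σ[ x ∈ V X ] Σ[ y ∈ V X ] (Vs (μ v) x × Vs (μ w) y × E X x y)

record Order (G : Graph) : Set₁ where
  field
    _⪯_     : V G → V G → Set
    isTotal : IsTotalOrder _≡_ _⪯_

  _≺_ : V G → V G → Set
  x ≺ y = x ⪯ y × x ≢ y

open Order public

record PathVia (G : Graph) (P : V G → Set) (v w : V G) (len : ℕ) : Set where
  field
    f        : Fin (suc len) → V G
    distinct : Injective _≡_ _≡_ f
    start    : f fzero ≡ v
    end      : f (fromℕ len) ≡ w
    step     : ∀ (i : Fin len) → E G (f (inject₁ i)) (f (fsuc i))
    internal : ∀ (i : Fin (suc len)) → 0 < toℕ i → toℕ i < len → P (f i)

Rset : (G : Graph) → Order G → V G → ℕ → V G → Set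
Rset G O v s w =
  _⪯_ O w v × Σ[ s' ∈ ℕ ] (s' ≤ s × PathVia G (λ u → _≺_ O v u) v w s')

Qset : (G : Graph) → Order G → V G → ℕ → V G → Set
Qset G O v s w =
  _⪯_ O w v × Σ[ s' ∈ ℕ ] (s' ≤ s × PathVia G (λ u → _≺_ O w u) v w s')

CardAtMost : {A : Set} → (A → Set) → ℕ → Set
CardAtMost {A} S k = Σ[ xs ∈ List A ] (length xs ≤ k × (∀ a → S a → a ∈ xs))

IsScol : Graph → ℕ → ℕ → Set₁
IsScol G s k =
  (Σ[ O ∈ Order G ] (∀ v → CardAtMost (Rset G O v s) k)) ×
  (∀ (O : Order G) (k' : ℕ) → (∀ v → CardAtMost (Rset G O v s) k') → k ≤ k')

IsWcol : Graph → ℕ → ℕ → Set₁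
IsWcol G s k =
  (Σ[ O ∈ Order G ] (∀ v → CardAtMost (Qset G O v s) k)) ×
  (∀ (O : Order G) (k' : ℕ) → (∀ v → CardAtMost (Qset G O v s) k') → k ≤ k')

{-# OPTIONS --safe #-}
-- Order G ⊠ K ℓ lexicographically, first by the given order of G and then by the index in K ℓ,
-- and order H by keys, the key of a vertex being the least vertex of its branch set.
-- A path of length t ≤ s in H from v to w whose inner vertices lie above v (resp. w) lifts through
-- the branch sets, each of radius ≤ r, to a walk from key v to key w of length ≤ t + 2r(t + 1)
-- ≤ 2rs + 2r + s.  All its vertices lie above key w in the weak case; in the strong case all its
-- vertices before the first one, y, that lies in the branch set of w below key v lie above key v.
-- Projecting to G and shortcutting to a path shows that the G-coordinate of key w (resp. y) lies
-- in Q (resp. R) of the G-coordinate of key v.  Each vertex of G has ℓ copies in G ⊠ K ℓ, each in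
-- at most one branch set, whence the factor ℓ.
module Submission where

open import Defs

open import Data.Empty using (⊥-elim)
open import Data.Fin as Fin using (Fin; toℕ; fromℕ; inject₁) renaming (zero to fzero; suc to fsuc)
import Data.Fin.Properties as Fin
open import Data.List
  using (List; []; _∷_; _++_; length; map; allFin; filter; find; mapMaybe; cartesianProduct)
import Data.List.Extrema
open import Data.List.Membership.Propositional using (_∈_)
open import Data.List.Membership.Propositional.Properties
  using (∈-map⁺; ∈-allFin; ∈-filter⁺; ∈-cartesianProduct⁺)
open import Data.List.Properties using (length-map; length-++; length-mapMaybe; length-tabulate)
import Data.List.Relation.Unary.All as All
open import Data.List.Relation.Unary.All.Properties using (all-filter)
open import Data.List.Relation.Unary.Any as Any using (here; there)
import Data.List.Relation.Unary.Any.Properties as Any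
open import Data.Maybe using (Maybe; just)
import Data.Maybe.Relation.Unary.Any as Maybe
open import Data.Nat using (ℕ; zero; suc; _≤_; _<_; _+_; _*_; z≤n; s≤s; _≤?_)
open import Data.Nat.Properties
  using (≤-refl; ≤-trans; ≤-pred; m≤n⇒m≤1+n; +-mono-≤; +-suc; <-irrefl; n≢0⇒n>0; ≤∧≢⇒<;
         +-identityʳ; *-comm; *-monoˡ-≤; module ≤-Reasoning)
open import Data.Nat.Tactic.RingSolver using (solve-∀)
open import Data.Product as Product using (Σ-syntax; ∃-syntax; _×_; _,_; proj₁; proj₂)
open import Data.Product.Relation.Binary.Lex.NonStrict using (×-Lex; ×-isTotalOrder)
open import Data.Product.Relation.Binary.Pointwise.NonDependent using (≡×≡⇒≡)
open import Data.Sum as Sum using (_⊎_; inj₁; inj₂)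
open import Data.Unit using (⊤; tt)
open import Function using (_∘_; id; _on_)
open import Function.Bundles using (Inverse; _↔_)
open import Relation.Binary.Bundles using (TotalOrder)
open import Relation.Binary.Consequences using (total∧dec⇒dec)
import Relation.Binary.Construct.On as On
open import Relation.Binary.Definitions using (DecidableEquality; Symmetric)
open import Relation.Binary.PropositionalEquality
  using (_≡_; _≢_; refl; sym; trans; cong; cong₂; subst; isEquivalence; module ≡-Reasoning)
open import Relation.Binary.Structures using (IsTotalOrder)
open import Relation.Nullary using (¬_; Dec; yes; no; contradiction)
open import Relation.Nullary.Decidable
  using (_⊎-dec_; _×-dec_; decidable-stable; ¬¬-excluded-middle)
open import Relation.Nullary.Negation using (¬¬-map)
open import Relation.Unary using (Decidable)

private
  variable
    A B : Set
    k m : ℕ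

module _ {R : A → A → Set} where

  private
    variable
      u x y z : A

  infix 4 _∈ʷ_ _⊆ʷ_

  _∈ʷ_ : A → Walk R x y k → Set
  u ∈ʷ nil {x = x}      = u ≡ x
  u ∈ʷ cons {x = x} _ w = u ≡ x ⊎ u ∈ʷ w

  _⊆ʷ_ : ∀ {x′ y′} → Walk R x y k → Walk R x′ y′ m → Set
  w ⊆ʷ w′ = ∀ {u} → u ∈ʷ w → u ∈ʷ w′

  ∈ʷ-start : (w : Walk R x y k) → x ∈ʷ w
  ∈ʷ-start nil        = refl
  ∈ʷ-start (cons _ _) = inj₁ refl

  ∈ʷ-dec : DecidableEquality A → (u : A) (w : Walk R x y k) → Dec (u ∈ʷ w)
  ∈ʷ-dec _≟_ u (nil {x = x})      = u ≟ x
  ∈ʷ-dec _≟_ u (cons {x = x} _ w) = (u ≟ x) ⊎-dec ∈ʷ-dec _≟_ u w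

  _++ʷ_ : Walk R x y k → Walk R y z m → Walk R x z (k + m)
  nil       ++ʷ w′ = w′
  cons e w  ++ʷ w′ = cons e (w ++ʷ w′)

  ∈ʷ-++⁻ : (w : Walk R x y k) {w′ : Walk R y z m} → u ∈ʷ w ++ʷ w′ → u ∈ʷ w ⊎ u ∈ʷ w′
  ∈ʷ-++⁻ nil        p        = inj₂ p
  ∈ʷ-++⁻ (cons e w) (inj₁ p) = inj₁ (inj₁ p)
  ∈ʷ-++⁻ (cons e w) (inj₂ p) = Sum.map₁ inj₂ (∈ʷ-++⁻ w p)

  ∈ʷ-subst : (eq : k ≡ m) (w : Walk R x y k) → u ∈ʷ subst (Walk R x y) eq w → u ∈ʷ w
  ∈ʷ-subst refl w p = p

  revApp : Symmetric R → Walk R y x k → Walk R y z m → Walk R x z (k + m)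
  revApp R-sym nil                acc = acc
  revApp R-sym (cons {k = k} e w) acc =
    subst (Walk R _ _) (+-suc k _) (revApp R-sym w (cons (R-sym e) acc))

  ∈ʷ-revApp⁻ : (R-sym : Symmetric R) (w : Walk R y x k) (acc : Walk R y z m) →
               u ∈ʷ revApp R-sym w acc → u ∈ʷ w ⊎ u ∈ʷ acc
  ∈ʷ-revApp⁻ R-sym nil        acc p = inj₂ p
  ∈ʷ-revApp⁻ R-sym (cons e w) acc p
    with ∈ʷ-revApp⁻ R-sym w (cons (R-sym e) acc) (∈ʷ-subst (+-suc _ _) _ p)
  ... | inj₁ q        = inj₁ (inj₂ q)
  ... | inj₂ (inj₁ q) = inj₁ (inj₂ (subst (_∈ʷ w) (sym q) (∈ʷ-start w)))
  ... | inj₂ (inj₂ q) = inj₂ q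

  Distinct : Walk R x y k → Set
  Distinct nil                = ⊤
  Distinct (cons {x = x} _ w) = ¬ x ∈ʷ w × Distinct w

  suffixFrom : (w : Walk R x z k) → y ∈ʷ w →
    ∃[ m ] (m ≤ k × Σ[ w′ ∈ Walk R y z m ] (w′ ⊆ʷ w × (Distinct w → Distinct w′)))
  suffixFrom nil        refl        = 0 , z≤n , nil , id , id
  suffixFrom (cons e w) (inj₁ refl) = _ , ≤-refl , cons e w , id , id
  suffixFrom (cons e w) (inj₂ y∈w)  =
    let m , m≤k , w′ , w′⊆w , distinct = suffixFrom w y∈w
    in m , m≤n⇒m≤1+n m≤k , w′ , inj₂ ∘ w′⊆w , distinct ∘ proj₂

  shortcut : DecidableEquality A → (w : Walk R x y k) →
    ∃[ m ] (m ≤ k × Σ[ w′ ∈ Walk R x y m ] (w′ ⊆ʷ w × Distinct w′))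
  shortcut _≟_ nil = 0 , z≤n , nil , id , tt
  shortcut _≟_ (cons {x = x} e w) with shortcut _≟_ w
  ... | m , m≤k , w′ , w′⊆w , distinct with ∈ʷ-dec _≟_ x w′
  ...   | yes x∈w′ =
          let m′ , m′≤m , w″ , w″⊆w′ , distinct′ = suffixFrom w′ x∈w′
          in m′ , m≤n⇒m≤1+n (≤-trans m′≤m m≤k) , w″ , inj₂ ∘ w′⊆w ∘ w″⊆w′ , distinct′ distinct
  ...   | no x∉w′  = suc m , s≤s m≤k , cons e w′ , Sum.map₂ w′⊆w , x∉w′ , distinct

  prefixUntil : {D : A → Set} → Decidable D → (w : Walk R x z k) → D z →
    ∃[ y ] (D y × ∃[ m ] (m ≤ k × Σ[ w′ ∈ Walk R x y m ]
      (∀ {u} → u ∈ʷ w′ → u ≡ y ⊎ (u ∈ʷ w × ¬ D u))))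
  prefixUntil D? (nil {x = x})      Dz = x , Dz , 0 , z≤n , nil , inj₁
  prefixUntil D? (cons {x = x} e w) Dz with D? x
  ... | yes Dx = x , Dx , 0 , z≤n , nil , inj₁
  ... | no ¬Dx =
        let y , Dy , m , m≤k , w′ , classify = prefixUntil D? w Dz
        in y , Dy , suc m , s≤s m≤k , cons e w′ , λ
             { (inj₁ refl) → inj₂ (inj₁ refl , ¬Dx)
             ; (inj₂ p)    → Sum.map₂ (Product.map₁ inj₂) (classify p) }

module _ {R R′ : A → A → Set} (f : ∀ {x y} → R x y → R′ x y) where

  private
    variable
      u x y : A

  mapʷ : Walk R x y k → Walk R′ x y k
  mapʷ nil        = nil
  mapʷ (cons e w) = cons (f e) (mapʷ w)

  ∈ʷ-mapʷ⁻ : (w : Walk R x y k) → u ∈ʷ mapʷ w → u ∈ʷ w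
  ∈ʷ-mapʷ⁻ nil        p        = p
  ∈ʷ-mapʷ⁻ (cons e w) (inj₁ p) = inj₁ p
  ∈ʷ-mapʷ⁻ (cons e w) (inj₂ p) = inj₂ (∈ʷ-mapʷ⁻ w p)

module _ {R : A → A → Set} {R′ : B → B → Set} (f : A → B)
         (f-edge : ∀ {x y} → R x y → f x ≡ f y ⊎ R′ (f x) (f y)) where

  private
    variable
      x y : A

  projectʷ : (w : Walk R x y k) →
    ∃[ m ] (m ≤ k × Σ[ w′ ∈ Walk R′ (f x) (f y) m ] (∀ {b} → b ∈ʷ w′ → ∃[ a ] (a ∈ʷ w × f a ≡ b)))
  projectʷ w = go w refl
    where
    go : ∀ {b} (w : Walk R x y k) → b ≡ f x →
      ∃[ m ] (m ≤ k × Σ[ w′ ∈ Walk R′ b (f y) m ] (∀ {b} → b ∈ʷ w′ → ∃[ a ] (a ∈ʷ w × f a ≡ b)))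
    go (nil {x = x}) refl = 0 , z≤n , nil , λ { refl → x , refl , refl }
    go (cons {x = x} e w) b≡fx with f-edge e
    ... | inj₁ fx≡fy =
          let m , m≤k , w′ , image = go w (trans b≡fx fx≡fy)
          in m , m≤n⇒m≤1+n m≤k , w′ , Product.map₂ (Product.map₁ inj₂) ∘ image
    go (cons {x = x} e w) refl | inj₂ e′ =
          let m , m≤k , w′ , image = go w refl
          in suc m , s≤s m≤k , cons e′ w′ , λ
               { (inj₁ refl) → x , inj₁ refl , refl
               ; (inj₂ p)    → Product.map₂ (Product.map₁ inj₂) (image p) }

module _ {X : Graph} (S : Subgraph X) where

  private
    variable
      u x y : V X

  ∈ʷ⇒Vs : Vs S x → (w : Walk (Es S) x y k) → u ∈ʷ w → Vs S u
  ∈ʷ⇒Vs x∈S nil        refl        = x∈S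
  ∈ʷ⇒Vs x∈S (cons e w) (inj₁ refl) = x∈S
  ∈ʷ⇒Vs x∈S (cons e w) (inj₂ p)    = ∈ʷ⇒Vs (proj₂ (Es-Vs S e)) w p

  radius⇒walk : ∀ {r} → RadiusAtMost r S → Vs S x → Vs S y → ∃[ k ] (k ≤ r + r × Walk (Es S) x y k)
  radius⇒walk (_ , _ , reach) x∈S y∈S =
    let k₁ , k₁≤r , w₁ = reach _ x∈S
        k₂ , k₂≤r , w₂ = reach _ y∈S
    in k₁ + k₂ , +-mono-≤ k₁≤r k₂≤r , revApp (Es-sym S) w₁ w₂

module _ (G : Graph) where

  private
    variable
      u x y : V G

  vertexAt : Walk (E G) x y k → Fin (suc k) → V G
  vertexAt (nil {x = x})      _        = x
  vertexAt (cons {x = x} _ w) fzero    = x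
  vertexAt (cons _ w)         (fsuc i) = vertexAt w i

  vertexAt-start : (w : Walk (E G) x y k) → vertexAt w fzero ≡ x
  vertexAt-start nil        = refl
  vertexAt-start (cons _ _) = refl

  vertexAt-end : (w : Walk (E G) x y k) → vertexAt w (fromℕ k) ≡ y
  vertexAt-end nil        = refl
  vertexAt-end (cons _ w) = vertexAt-end w

  vertexAt-∈ʷ : (w : Walk (E G) x y k) (i : Fin (suc k)) → vertexAt w i ∈ʷ w
  vertexAt-∈ʷ nil        i        = refl
  vertexAt-∈ʷ (cons _ w) fzero    = inj₁ refl
  vertexAt-∈ʷ (cons _ w) (fsuc i) = inj₂ (vertexAt-∈ʷ w i)

  vertexAt-step : (w : Walk (E G) x y k) (i : Fin k) →
                  E G (vertexAt w (inject₁ i)) (vertexAt w (fsuc i))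
  vertexAt-step (cons {x = x} e w) fzero    = subst (E G x) (sym (vertexAt-start w)) e
  vertexAt-step (cons e w)         (fsuc i) = vertexAt-step w i

  vertexAt-injective : (w : Walk (E G) x y k) → Distinct w →
                       ∀ {i j} → vertexAt w i ≡ vertexAt w j → i ≡ j
  vertexAt-injective nil        _              {fzero}  {fzero}  _  = refl
  vertexAt-injective (cons e w) _              {fzero}  {fzero}  _  = refl
  vertexAt-injective (cons e w) (x∉w , _)      {fzero}  {fsuc j} eq =
    contradiction (subst (_∈ʷ w) (sym eq) (vertexAt-∈ʷ w j)) x∉w
  vertexAt-injective (cons e w) (x∉w , _)      {fsuc i} {fzero}  eq =
    contradiction (subst (_∈ʷ w) eq (vertexAt-∈ʷ w i)) x∉w
  vertexAt-injective (cons e w) (_ , distinct) {fsuc i} {fsuc j} eq =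
    cong fsuc (vertexAt-injective w distinct eq)

  distinct⇒pathVia : {P : V G → Set} (w : Walk (E G) x y k) → Distinct w →
    (∀ {u} → u ∈ʷ w → u ≡ x ⊎ u ≡ y ⊎ P u) → PathVia G P x y k
  distinct⇒pathVia {x = x} {y} {k} {P = P} w distinct classify = record
    { f        = vertexAt w
    ; distinct = vertexAt-injective w distinct
    ; start    = vertexAt-start w
    ; end      = vertexAt-end w
    ; step     = vertexAt-step w
    ; internal = internal }
    where
    injective : ∀ {i j} → vertexAt w i ≡ vertexAt w j → i ≡ j
    injective = vertexAt-injective w distinct
    internal : ∀ i → 0 < toℕ i → toℕ i < k → P (vertexAt w i)
    internal i 0<i i<k with classify (vertexAt-∈ʷ w i)
    ... | inj₁ at-start with injective (trans at-start (sym (vertexAt-start w)))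
    ...   | refl = contradiction 0<i (<-irrefl refl)
    internal i 0<i i<k | inj₂ (inj₁ at-end) with injective (trans at-end (sym (vertexAt-end w)))
    ...   | refl = contradiction i<k (<-irrefl (Fin.toℕ-fromℕ k))
    internal i 0<i i<k | inj₂ (inj₂ Pu) = Pu

  pathVia-internal : {P : V G → Set} {t : ℕ} (p : PathVia G P x y t) (i : Fin (suc t)) →
    PathVia.f p i ≢ x → PathVia.f p i ≢ y → P (PathVia.f p i)
  pathVia-internal {x = x} {y} {t = t} p i f≢x f≢y =
    internal i (n≢0⇒n>0 (f≢x ∘ at-start)) (≤∧≢⇒< (≤-pred (Fin.toℕ<n i)) (f≢y ∘ at-end))
    where
    open PathVia p
    at-start : toℕ i ≡ 0 → f i ≡ x
    at-start eq = trans (cong f (Fin.toℕ-injective {j = fzero} eq)) start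
    at-end : toℕ i ≡ t → f i ≡ y
    at-end eq = trans (cong f (Fin.toℕ-injective (trans eq (sym (Fin.toℕ-fromℕ t))))) end

  walk⇒pathVia : {P : V G → Set} (w : Walk (E G) x y k) → (∀ {u} → u ∈ʷ w → u ≡ x ⊎ u ≡ y ⊎ P u) →
    ∃[ m ] (m ≤ k × PathVia G P x y m)
  walk⇒pathVia w classify =
    let m , m≤k , w′ , w′⊆w , distinct = shortcut (_≟V_ G) w
    in m , m≤k , distinct⇒pathVia w′ distinct (classify ∘ w′⊆w)

⊠-walk⇒pathVia : (G B : Graph) {P : V G → Set} {x y : V (G ⊠ B)} (w : Walk (E (G ⊠ B)) x y k) →
  (∀ {u} → u ∈ʷ w → proj₁ u ≡ proj₁ x ⊎ proj₁ u ≡ proj₁ y ⊎ P (proj₁ u)) →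
  ∃[ m ] (m ≤ k × PathVia G P (proj₁ x) (proj₁ y) m)
⊠-walk⇒pathVia G B {P} {x} {y} w classify =
  let m , m≤k , w′ , image = projectʷ proj₁ (proj₁ ∘ proj₂) w
      m′ , m′≤m , path = walk⇒pathVia G w′ (classify-image ∘ image)
  in m′ , ≤-trans m′≤m m≤k , path
  where
  classify-image : ∀ {g} → ∃[ a ] (a ∈ʷ w × proj₁ a ≡ g) → g ≡ proj₁ x ⊎ g ≡ proj₁ y ⊎ P g
  classify-image (a , a∈w , refl) = classify a∈w

vertices : (G : Graph) → List (V G)
vertices G = map (Inverse.from (enum G)) (allFin (size G))

∈-vertices : (G : Graph) (x : V G) → x ∈ vertices G
∈-vertices G x = subst (_∈ vertices G) (Inverse.strictlyInverseʳ (enum G) x)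
  (∈-map⁺ (Inverse.from (enum G)) (∈-allFin (Inverse.to (enum G) x)))

find-just : {P : A → Set} (P? : Decidable P) {xs : List A} {x : A} → x ∈ xs → P x →
            ∃[ y ] (find P? xs ≡ just y × P y)
find-just P? {y ∷ _} x∈xs Px with P? y | x∈xs
... | yes Py | _          = y , refl , Py
... | no ¬Py | here refl  = contradiction Px ¬Py
... | no _   | there x∈ys = find-just P? x∈ys Px

∈-mapMaybe⁺ : (f : A → Maybe B) {xs : List A} {a : A} {b : B} →
              a ∈ xs → f a ≡ just b → b ∈ mapMaybe f xs
∈-mapMaybe⁺ f {xs} a∈xs fa≡b =
  Any.mapMaybe⁺ f xs (Any.map⁺ (Any.map (λ { refl → fa-hits-b }) a∈xs))
  where
  fa-hits-b : Maybe.Any (_ ≡_) (f _)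
  fa-hits-b = subst (Maybe.Any (_ ≡_)) (sym fa≡b) (Maybe.just refl)

length-cartesianProduct : (xs : List A) (ys : List B) →
                          length (cartesianProduct xs ys) ≡ length xs * length ys
length-cartesianProduct []       ys = refl
length-cartesianProduct (x ∷ xs) ys = begin
  length (map (x ,_) ys ++ cartesianProduct xs ys)          ≡⟨ length-++ (map (x ,_) ys) ⟩
  length (map (x ,_) ys) + length (cartesianProduct xs ys)  ≡⟨ cong₂ _+_ (length-map (x ,_) ys)
                                                                          (length-cartesianProduct xs ys) ⟩
  length ys + length xs * length ys                         ∎
  where open ≡-Reasoning

cardAtMost-mapMaybe : (f : A → Maybe B) {S : A → Set} {T : B → Set} → CardAtMost S k →
                      (∀ b → T b → ∃[ a ] (S a × f a ≡ just b)) → CardAtMost T k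
cardAtMost-mapMaybe f (xs , |xs|≤k , S⊆xs) T⊆image =
  mapMaybe f xs , ≤-trans (length-mapMaybe f xs) |xs|≤k , λ b Tb →
    let a , Sa , fa≡b = T⊆image b Tb in ∈-mapMaybe⁺ f (S⊆xs a Sa) fa≡b

cardAtMost-×Fin : ∀ ℓ {S : A → Set} → CardAtMost S k → CardAtMost {A × Fin ℓ} (S ∘ proj₁) (ℓ * k)
cardAtMost-×Fin {k = k} ℓ (xs , |xs|≤k , S⊆xs) =
  cartesianProduct xs (allFin ℓ) , |xs×ℓ|≤ℓk ,
  λ { (a , i) Sa → ∈-cartesianProduct⁺ (S⊆xs a Sa) (∈-allFin i) }
  where
  |xs×ℓ|≤ℓk : length (cartesianProduct xs (allFin ℓ)) ≤ ℓ * k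
  |xs×ℓ|≤ℓk = begin
    length (cartesianProduct xs (allFin ℓ))  ≡⟨ length-cartesianProduct xs (allFin ℓ) ⟩
    length xs * length (allFin ℓ)            ≡⟨ cong (length xs *_) (length-tabulate id) ⟩
    length xs * ℓ                            ≤⟨ *-monoˡ-≤ ℓ |xs|≤k ⟩
    k * ℓ                                    ≡⟨ *-comm k ℓ ⟩
    ℓ * k                                    ∎
    where open ≤-Reasoning

¬¬-∀-Fin : ∀ n {B : Fin n → Set} → (∀ i → ¬ ¬ B i) → ¬ ¬ (∀ i → B i)
¬¬-∀-Fin zero    ¬¬B k = k λ ()
¬¬-∀-Fin (suc n) ¬¬B k =
  ¬¬B fzero λ B₀ → ¬¬-∀-Fin n (¬¬B ∘ fsuc) λ B₊ → k λ { fzero → B₀ ; (fsuc i) → B₊ i }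

¬¬-∀-↔Fin : ∀ {n} {B : A → Set} → A ↔ Fin n → (∀ a → ¬ ¬ B a) → ¬ ¬ (∀ a → B a)
¬¬-∀-↔Fin {B = B} A↔Fin ¬¬B =
  ¬¬-map (λ B-all a → subst B (strictlyInverseʳ a) (B-all (to a))) (¬¬-∀-Fin _ (¬¬B ∘ from))
  where open Inverse A↔Fin

isTotalOrder-≡ : {_≈_ _≤_ : A → A → Set} → (∀ {x y} → x ≈ y → x ≡ y) →
                 IsTotalOrder _≈_ _≤_ → IsTotalOrder _≡_ _≤_
isTotalOrder-≡ ≈⇒≡ to = record
  { isPartialOrder = record
    { isPreorder = record
      { isEquivalence = isEquivalence
      ; reflexive     = λ { refl → ≤-refl′ }
      ; trans         = ≤-trans′ }
    ; antisym = λ x≤y y≤x → ≈⇒≡ (antisym x≤y y≤x) }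
  ; total = total }
  where open IsTotalOrder to using (antisym; total) renaming (refl to ≤-refl′; trans to ≤-trans′)

module Lex (G : Graph) (ℓ : ℕ) (O : Order G) where

  private
    X : Graph
    X = G ⊠ K ℓ
    π : V X → V G
    π = proj₁
    variable
      a b c u : V X

  _⊑_ : V X → V X → Set
  _⊑_ = ×-Lex _≡_ (_⪯_ O) Fin._≤_

  ⊑-isTotalOrder : IsTotalOrder _≡_ _⊑_
  ⊑-isTotalOrder = isTotalOrder-≡ ≡×≡⇒≡ (×-isTotalOrder (_≟V_ G) (isTotal O) Fin.≤-isTotalOrder)

  ⊑-totalOrder : TotalOrder _ _ _
  ⊑-totalOrder = record { isTotalOrder = ⊑-isTotalOrder }

  open IsTotalOrder ⊑-isTotalOrder public
    using ()
    renaming (reflexive to ⊑-reflexive; refl to ⊑-refl; trans to ⊑-trans;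
              antisym to ⊑-antisym; total to ⊑-total)

  _⊑?_ : (a b : V X) → Dec (a ⊑ b)
  _⊑?_ = total∧dec⇒dec ⊑-reflexive ⊑-antisym ⊑-total (_≟V_ X)

  ⊑⇒≡⊎≺ : a ⊑ b → π a ≡ π b ⊎ _≺_ O (π a) (π b)
  ⊑⇒≡⊎≺ (inj₁ a≺b)       = inj₂ a≺b
  ⊑⇒≡⊎≺ (inj₂ (a≡b , _)) = inj₁ a≡b

  ⊑⇒⪯ : a ⊑ b → _⪯_ O (π a) (π b)
  ⊑⇒⪯ a⊑b with ⊑⇒≡⊎≺ a⊑b
  ... | inj₁ refl      = IsTotalOrder.refl (isTotal O)
  ... | inj₂ (a⪯b , _) = a⪯b

  ≰⇒⊒ : ¬ a ⊑ b → b ⊑ a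
  ≰⇒⊒ {a} {b} a⋢b with ⊑-total a b
  ... | inj₁ a⊑b = contradiction a⊑b a⋢b
  ... | inj₂ b⊑a = b⊑a

  ⊑-walk⇒pathVia : (W : Walk (E X) a b k) → c ≡ a ⊎ c ≡ b → (∀ {u} → u ∈ʷ W → u ≡ b ⊎ c ⊑ u) →
    ∃[ m ] (m ≤ k × PathVia G (_≺_ O (π c)) (π a) (π b) m)
  ⊑-walk⇒pathVia {a = a} {b} {c = c} W c-end above =
    ⊠-walk⇒pathVia G (K ℓ) W (classify c-end ∘ above)
    where
    classify : c ≡ a ⊎ c ≡ b → u ≡ b ⊎ c ⊑ u → π u ≡ π a ⊎ π u ≡ π b ⊎ _≺_ O (π c) (π u)
    classify _ (inj₁ refl) = inj₂ (inj₁ refl)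
    classify c-end (inj₂ c⊑u) with ⊑⇒≡⊎≺ c⊑u | c-end
    ... | inj₂ c≺u | _         = inj₂ (inj₂ c≺u)
    ... | inj₁ c≡u | inj₁ refl = inj₁ (sym c≡u)
    ... | inj₁ c≡u | inj₂ refl = inj₂ (inj₁ (sym c≡u))

module BranchSets {r : ℕ} {H X : Graph} (M : ShallowMinor r H X) where

  open ShallowMinor M

  private
    variable
      a b u x : V X
      v w : V H

  branchSet-unique : Vs (μ v) x → Vs (μ w) x → v ≡ w
  branchSet-unique {v} {x} {w} x∈v x∈w with _≟V_ H v w
  ... | yes v≡w = v≡w
  ... | no v≢w  = ⊥-elim (disjoint v≢w x x∈v x∈w)

  branchWalk : Vs (μ v) a → Vs (μ v) b →
    ∃[ k ] (k ≤ r + r × Σ[ W ∈ Walk (E X) a b k ] (∀ {u} → u ∈ʷ W → Vs (μ v) u))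
  branchWalk {v} a∈v b∈v =
    let k , k≤2r , w = radius⇒walk (μ v) (radius v) a∈v b∈v
    in k , k≤2r , mapʷ (Es⊆E (μ v)) w , ∈ʷ⇒Vs (μ v) a∈v w ∘ ∈ʷ-mapʷ⁻ (Es⊆E (μ v)) w

  -- Inside each branch set a walk of length ≤ 2r, between consecutive ones an edge of the minor.
  liftWalk : ∀ n (f : Fin (suc n) → V H) → (∀ i → E H (f (inject₁ i)) (f (fsuc i))) →
    Vs (μ (f fzero)) a → Vs (μ (f (fromℕ n))) b →
    ∃[ k ] (k ≤ n + suc n * (r + r) × Σ[ W ∈ Walk (E X) a b k ]
      (∀ {u} → u ∈ʷ W → ∃[ i ] Vs (μ (f i)) u))
  liftWalk zero f step a∈ b∈ =
    let k , k≤2r , W , inside = branchWalk a∈ b∈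
    in k , subst (k ≤_) (sym (+-identityʳ (r + r))) k≤2r , W , (fzero ,_) ∘ inside
  liftWalk (suc n) f step a∈ b∈ with edges (step fzero)
  ... | x , y , x∈ , y∈ , x~y
      with branchWalk a∈ x∈ | liftWalk n (f ∘ fsuc) (step ∘ fsuc) y∈ b∈
  ... | k₁ , k₁≤2r , W₁ , inside₁ | k₂ , k₂≤ , W₂ , inside₂ =
    k₁ + suc k₂ , bound , W₁ ++ʷ cons x~y W₂ , covered
    where
    bound : k₁ + suc k₂ ≤ suc n + suc (suc n) * (r + r)
    bound = begin
      k₁ + suc k₂                          ≤⟨ +-mono-≤ k₁≤2r (s≤s k₂≤) ⟩
      r + r + suc (n + suc n * (r + r))    ≡⟨ identity n (r + r) ⟩
      suc n + suc (suc n) * (r + r)        ∎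
      where
      open ≤-Reasoning
      identity : ∀ n q → q + suc (n + suc n * q) ≡ suc n + suc (suc n) * q
      identity = solve-∀
    covered : ∀ {u} → u ∈ʷ W₁ ++ʷ cons x~y W₂ → ∃[ i ] Vs (μ (f i)) u
    covered p with ∈ʷ-++⁻ W₁ p
    ... | inj₁ q           = fzero , inside₁ q
    ... | inj₂ (inj₁ refl) = fzero , x∈
    ... | inj₂ (inj₂ q)    = let i , u∈ = inside₂ q in fsuc i , u∈

  module _ (decV : ∀ v x → Dec (Vs (μ v) x)) where

    owner : V X → Maybe (V H)
    owner x = find (λ v → decV v x) (vertices H)

    owner-spec : Vs (μ w) x → owner x ≡ just w
    owner-spec {w} {x} x∈w =
      let v , owner≡v , x∈v = find-just (λ v → decV v x) (∈-vertices H w) x∈w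
      in trans owner≡v (cong just (branchSet-unique x∈v x∈w))

    cardAtMost-owners : ∀ {S : V X → Set} {T : V H → Set} {k} → CardAtMost S k →
      (∀ w → T w → ∃[ x ] (Vs (μ w) x × S x)) → CardAtMost T k
    cardAtMost-owners card T⊆owners = cardAtMost-mapMaybe owner card λ w Tw →
      let x , x∈w , Sx = T⊆owners w Tw in x , Sx , owner-spec x∈w

path-length-bound : ∀ {r s t} → t ≤ s → t + suc t * (r + r) ≤ 2 * r * s + 2 * r + s
path-length-bound {r} {s} {t} t≤s = begin
  t + suc t * (r + r)     ≤⟨ +-mono-≤ t≤s (*-monoˡ-≤ (r + r) (s≤s t≤s)) ⟩
  s + suc s * (r + r)     ≡⟨ identity r s ⟩
  2 * r * s + 2 * r + s   ∎
  where
  open ≤-Reasoning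
  identity : ∀ r s → s + suc s * (r + r) ≡ 2 * r * s + 2 * r + s
  identity = solve-∀

module KeyOrder {r ℓ : ℕ} (G : Graph) {H : Graph} (M : ShallowMinor r H (G ⊠ K ℓ))
                (decV : ∀ v x → Dec (Vs (ShallowMinor.μ M v) x)) (O : Order G) where

  open ShallowMinor M
  open BranchSets M
  open Lex G ℓ O
  open Data.List.Extrema ⊑-totalOrder using (min; min≤xs; argmin-all)

  private
    X : Graph
    X = G ⊠ K ℓ
    π : V X → V G
    π = proj₁
    variable
      s t : ℕ
      u : V X
      v w : V H

  key : V H → V X
  key v = min (proj₁ (radius v)) (filter (decV v) (vertices X))

  key∈μ : ∀ v → Vs (μ v) (key v)
  key∈μ v = argmin-all id (proj₁ (proj₂ (radius v))) (all-filter (decV v) (vertices X))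

  key-least : Vs (μ v) u → key v ⊑ u
  key-least {v} {u} u∈v =
    All.lookup (min≤xs _ (filter (decV v) (vertices X))) (∈-filter⁺ (decV v) (∈-vertices X u) u∈v)

  key-injective : key v ≡ key w → v ≡ w
  key-injective {v} {w} eq = branchSet-unique (subst (Vs (μ v)) eq (key∈μ v)) (key∈μ w)

  orderH : Order H
  orderH = record
    { _⪯_     = _⊑_ on key
    ; isTotal = isTotalOrder-≡ key-injective (On.isTotalOrder key ⊑-isTotalOrder) }

  walkBetweenKeys : ∀ {P : V H → Set} (p : PathVia H P v w t) → t ≤ s → ∀ c → c ⊑ key v →
    (∀ {h} → P h → c ⊑ key h) →
    ∃[ k ] (k ≤ 2 * r * s + 2 * r + s × Σ[ W ∈ Walk (E X) (key v) (key w) k ]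
      (∀ {u} → u ∈ʷ W → Vs (μ w) u ⊎ c ⊑ u))
  walkBetweenKeys {v} {w} {t} p t≤s c c⊑v c⊑P =
    let k , k≤ , W , covered = liftWalk t f step key-v∈ key-w∈
    in k , ≤-trans k≤ (path-length-bound {r} t≤s) , W , classify ∘ covered
    where
    open PathVia p
    key-v∈ : Vs (μ (f fzero)) (key v)
    key-v∈ = subst (λ h → Vs (μ h) (key v)) (sym start) (key∈μ v)
    key-w∈ : Vs (μ (f (fromℕ t))) (key w)
    key-w∈ = subst (λ h → Vs (μ h) (key w)) (sym end) (key∈μ w)
    classify : ∃[ i ] Vs (μ (f i)) u → Vs (μ w) u ⊎ c ⊑ u
    classify (i , u∈) with _≟V_ H (f i) w | _≟V_ H (f i) v
    ... | yes fi≡w | _        = inj₁ (subst (λ h → Vs (μ h) _) fi≡w u∈)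
    ... | no _     | yes fi≡v = inj₂ (⊑-trans c⊑v (key-least (subst (λ h → Vs (μ h) _) fi≡v u∈)))
    ... | no fi≢w  | no fi≢v  = inj₂ (⊑-trans (c⊑P (pathVia-internal H p i fi≢v fi≢w)) (key-least u∈))

  Rset-key : Rset H orderH v s w →
             ∃[ y ] (Vs (μ w) y × Rset G O (π (key v)) (2 * r * s + 2 * r + s) (π y))
  Rset-key {v} {s} {w} (w⊑v , t , t≤s , p)
    with walkBetweenKeys p t≤s (key v) ⊑-refl proj₁
  ... | k , k≤ , W , above
    with prefixUntil {D = λ u → Vs (μ w) u × u ⊑ key v} (λ u → decV w u ×-dec (u ⊑? key v))
                     W (key∈μ w , w⊑v)
  ... | y , (y∈w , y⊑v) , m , m≤k , W′ , classify =
    let m′ , m′≤m , path = ⊑-walk⇒pathVia W′ (inj₁ refl) (beyond ∘ classify)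
    in y , y∈w , ⊑⇒⪯ y⊑v , m′ , ≤-trans m′≤m (≤-trans m≤k k≤) , path
    where
    beyond : u ≡ y ⊎ (u ∈ʷ W × ¬ (Vs (μ w) u × u ⊑ key v)) → u ≡ y ⊎ key v ⊑ u
    beyond (inj₁ u≡y) = inj₁ u≡y
    beyond (inj₂ (u∈W , u∉D)) with above u∈W
    ... | inj₁ u∈w = inj₂ (≰⇒⊒ (λ u⊑v → u∉D (u∈w , u⊑v)))
    ... | inj₂ v⊑u = inj₂ v⊑u

  Qset-key : Qset H orderH v s w → Qset G O (π (key v)) (2 * r * s + 2 * r + s) (π (key w))
  Qset-key {v} {s} {w} (w⊑v , t , t≤s , p) =
    let k , k≤ , W , above = walkBetweenKeys p t≤s (key w) w⊑v proj₁
        m , m≤k , path = ⊑-walk⇒pathVia W (inj₂ refl) (inj₂ ∘ Sum.[ key-least , id ] ∘ above)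
    in ⊑⇒⪯ w⊑v , m , ≤-trans m≤k k≤ , path

  Rset-cardAtMost : ∀ {b} → (∀ g → CardAtMost (Rset G O g (2 * r * s + 2 * r + s)) b) →
                    ∀ v → CardAtMost (Rset H orderH v s) (ℓ * b)
  Rset-cardAtMost bounded v =
    cardAtMost-owners decV (cardAtMost-×Fin ℓ (bounded (π (key v)))) λ _ → Rset-key

  Qset-cardAtMost : ∀ {b} → (∀ g → CardAtMost (Qset G O g (2 * r * s + 2 * r + s)) b) →
                    ∀ v → CardAtMost (Qset H orderH v s) (ℓ * b)
  Qset-cardAtMost bounded v =
    cardAtMost-owners decV (cardAtMost-×Fin ℓ (bounded (π (key v))))
      λ w Qvw → key w , key∈μ w , Qset-key Qvw

theorem18 : (G : Graph) (r ℓ : ℕ) → 1 ≤ ℓ → (H : Graph) →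
    ShallowMinor r H (G ⊠ K ℓ) → (s : ℕ) → 1 ≤ s →
    ((a b : ℕ) → IsScol H s a → IsScol G (2 * r * s + 2 * r + s) b → a ≤ ℓ * b) ×
    ((a b : ℕ) → IsWcol H s a → IsWcol G (2 * r * s + 2 * r + s) b → a ≤ ℓ * b)
theorem18 G r ℓ _ H M s _ = scol-bound , wcol-bound
  where
  open KeyOrder G M
  -- Membership in branch sets is not decidable in general, but it is under ¬¬ as the graphs are
  -- finite, and that suffices because the inequalities to prove are decidable.
  ¬¬-decidable : ¬ ¬ (∀ v x → Dec (Vs (ShallowMinor.μ M v) x))
  ¬¬-decidable = ¬¬-∀-↔Fin (enum H) λ v → ¬¬-∀-↔Fin (enum (G ⊠ K ℓ)) λ x → ¬¬-excluded-middle

  scol-bound : (a b : ℕ) → IsScol H s a → IsScol G (2 * r * s + 2 * r + s) b → a ≤ ℓ * b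
  scol-bound a b (_ , a-least) ((O , bounded) , _) = decidable-stable (a ≤? ℓ * b)
    (¬¬-map (λ decV → a-least (orderH decV O) (ℓ * b) (Rset-cardAtMost decV O bounded)) ¬¬-decidable)

  wcol-bound : (a b : ℕ) → IsWcol H s a → IsWcol G (2 * r * s + 2 * r + s) b → a ≤ ℓ * b
  wcol-bound a b (_ , a-least) ((O , bounded) , _) = decidable-stable (a ≤? ℓ * b)
    (¬¬-map (λ decV → a-least (orderH decV O) (ℓ * b) (Qset-cardAtMost decV O bounded)) ¬¬-decidable)
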